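{- For every positive integer $n$, $$P(S_n;x)=\sum_{i=1}^n\binom{i}{n-i}x(x-1)^{i-1}.$$
   Context: $S_n$ is the tournament on vertex set $\{v_1,\ldots,v_n\}$ obtained as follows: start from the acyclic tournament in which, for $i>j$, the edge between $v_i$ and $v_j$ is oriented from $v_i$ to $v_j$ (so the out-neighbors of $v_i$ are $v_1,\ldots,v_{i-1}$), and then reverse the edges of the Hamiltonian path $v_n,v_{n-1},\ldots,v_1$ (i.e. for each $i=1,\ldots,n-1$ the edge between $v_i$ and $v_{i+1}$ is oriented from $v_i$ to $v_{i+1}$). For a positive integer $k$, a proper $k$-coloring of a digraph $D$ is a map $V(D)\to\{1,\ldots,k\}$ such that each color class induces a subdigraph with no directed cycle; the number of them is a polynomial $P(D;x)$ in $x=k$, the chromatic polynomial of $D$. -}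

module Defs where

open import Data.Nat using (ℕ; zero; suc; _+_; _*_; _∸_; _^_; _<_)
open import Data.Nat.Combinatorics using (_C_)
open import Data.Fin using (Fin; toℕ; inject₁; fromℕ) renaming (zero to fzero; suc to fsuc)
open import Data.Vec using (Vec; lookup)
open import Data.List using (List; length; map; upTo)
open import Data.Nat.ListAction using (sum)
open import Data.List.Relation.Unary.Unique.Propositional using (Unique)
open import Data.List.Membership.Propositional using (_∈_)
open import Data.Product using (Σ; _×_; Σ-syntax)
open import Data.Sum using (_⊎_)
open import Function.Definitions using (Injective)
open import Function.Bundles using (_⇔_)
open import Relation.Binary.PropositionalEquality using (_≡_)
open import Relation.Nullary using (¬_)

Digraph : ℕ → Set₁
Digraph n = Fin n → Fin n → Set

-- The tournament S_n: vertex v_{i+1} is represented by the index i : Fin n.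
-- Edge a → b iff (b < a and a is not b+1)   [acyclic edges not on the path]
--              or b = a + 1                 [reversed Hamiltonian path edges]
S : (n : ℕ) → Digraph n
S n a b = (toℕ b < toℕ a × ¬ (toℕ a ≡ suc (toℕ b))) ⊎ (toℕ b ≡ suc (toℕ a))

HasDirectedCycleIn : ∀ {n} → Digraph n → (Fin n → Set) → Set
HasDirectedCycleIn {n} D X =
  Σ[ m ∈ ℕ ] Σ[ f ∈ (Fin (suc m) → Fin n) ]
    Injective _≡_ _≡_ f
    × (∀ i → X (f i))
    × (∀ (i : Fin m) → D (f (inject₁ i)) (f (fsuc i)))
    × D (f (fromℕ m)) (f fzero)

Proper : ∀ {n k} → Digraph n → Vec (Fin k) n → Set
Proper {n} {k} D c = ∀ (col : Fin k) → ¬ HasDirectedCycleIn D (λ v → lookup c v ≡ col)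

NumProperColorings : ∀ {n} → Digraph n → (k N : ℕ) → Set
NumProperColorings {n} D k N =
  Σ[ L ∈ List (Vec (Fin k) n) ]
    Unique L × (∀ c → Proper D c ⇔ (c ∈ L)) × length L ≡ N

-- Right-hand side: Σ_{i=1}^n C(i, n-i) x (x-1)^{i-1}, evaluated at x = k
-- (index j = i - 1 runs over 0 … n-1).
rhs : ℕ → ℕ → ℕ
rhs n x = sum (map (λ j → (suc j C (n ∸ suc j)) * x * (x ∸ 1) ^ j) (upTo n))

module Submission where

-- A colouring of S_n is proper iff no three consecutive vertices v_i, v_{i+1},
-- v_{i+2} share a colour.  Such a triple spans the directed 3-cycle
-- v_i → v_{i+1} → v_{i+2} → v_i.  Conversely, every edge of S_n other than a
-- path edge v_i → v_{i+1} descends by at least two, so in a directed cycle the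
-- vertex of largest index is entered by the path edge from its predecessor,
-- which in turn is entered by the path edge from the vertex before it.
--
-- Hence the proper k-colourings are the words of length n over k letters with
-- no three equal consecutive letters.  Such a word is a sequence of runs of
-- length 1 or 2, adjacent runs having different letters; with r + 1 runs there
-- are C(r+1, n-r-1) choices of run lengths and k(k-1)^r choices of letters.

open import Defs
open import Data.Nat using (ℕ; zero; suc; _+_; _*_; _∸_; _^_; _≤_; _<_; _≥_)
open import Data.Nat.Properties
  using ( +-comm; +-assoc; *-zeroʳ; *-identityʳ; *-distribˡ-+; *-distribʳ-+; +-∸-assoc; n∸n≡0
        ; +-cancelʳ-≡; suc-injective; ≤-refl; ≤-antisym; ≤-pred; m<n⇒m<1+n; m≤n⇒m≤1+n; n<1+n
        ; 1+n≢n; ≤-totalOrder)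
open import Data.Nat.Combinatorics using (_C_; nCk+nC[k+1]≡[n+1]C[k+1])
open import Data.Nat.ListAction using (sum)
open import Data.Nat.Tactic.RingSolver using (solve-∀)
open import Data.Fin using (Fin; toℕ; inject₁; fromℕ; punchIn; punchOut; _≟_)
  renaming (zero to fzero; suc to fsuc)
open import Data.Fin.Properties
  using (toℕ-injective; punchIn-injective; punchInᵢ≢i; punchIn-punchOut)
open import Data.Vec using (Vec; []; _∷_; lookup; head)
open import Data.Vec.Properties using (∷-injectiveˡ; ∷-injectiveʳ)
open import Data.List using (List; []; _∷_; _++_; map; concatMap; length; upTo; applyUpTo; allFin)
open import Data.List.Properties using (length-map; length-++; length-tabulate; map-upTo)
open import Data.List.Relation.Unary.All as All using (All)
open import Data.List.Relation.Unary.All.Properties as All using ()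
open import Data.List.Relation.Unary.AllPairs as AllPairs using ()
open import Data.List.Relation.Unary.AllPairs.Properties as AllPairs using ()
open import Data.List.Relation.Unary.Any using (here)
open import Data.List.Relation.Unary.Unique.Propositional using (Unique)
open import Data.List.Relation.Unary.Unique.Propositional.Properties
  using (map⁺; ++⁺; concat⁺; allFin⁺)
open import Data.List.Relation.Binary.Disjoint.Propositional using (Disjoint)
open import Data.List.Membership.Propositional using (_∈_; find; lose)
open import Data.List.Membership.Propositional.Properties
  using (∈-map⁺; ∈-map⁻; ∈-++⁺ˡ; ∈-++⁺ʳ; ∈-++⁻; ∈-allFin; ∈-concatMap⁺; ∈-concatMap⁻)
open import Data.List.Extrema ≤-totalOrder using (argmax; f[xs]≤f[argmax])
open import Data.Maybe using (Maybe; just; nothing)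
open import Data.Product using (_×_; Σ-syntax; _,_; proj₁; proj₂)
open import Data.Sum using (inj₁; inj₂)
open import Data.Unit using (⊤; tt)
open import Data.Empty using (⊥-elim)
open import Function using (_∘_; id)
open import Function.Bundles using (_⇔_; mk⇔)
open import Function.Construct.Composition using (_⇔-∘_)
open import Relation.Binary.PropositionalEquality
open import Relation.Nullary using (¬_; yes; no)

sumBelow : ℕ → (ℕ → ℕ) → ℕ
sumBelow zero    f = 0
sumBelow (suc m) f = sumBelow m f + f m

syntax sumBelow m (λ r → e) = ∑[ r < m ] e

sumBelow-cong : ∀ m {f g : ℕ → ℕ} → (∀ r → r < m → f r ≡ g r) → sumBelow m f ≡ sumBelow m g
sumBelow-cong zero    eq = refl
sumBelow-cong (suc m) eq =
  cong₂ _+_ (sumBelow-cong m (λ r r<m → eq r (m<n⇒m<1+n r<m))) (eq m ≤-refl)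

sumBelow-shift : ∀ m (f : ℕ → ℕ) → sumBelow (suc m) f ≡ f 0 + sumBelow m (f ∘ suc)
sumBelow-shift zero    f = +-comm 0 (f 0)
sumBelow-shift (suc m) f = begin
  sumBelow (suc m) f + f (suc m)           ≡⟨ cong (_+ f (suc m)) (sumBelow-shift m f) ⟩
  f 0 + sumBelow m (f ∘ suc) + f (suc m)   ≡⟨ +-assoc (f 0) _ _ ⟩
  f 0 + sumBelow (suc m) (f ∘ suc)         ∎
  where open ≡-Reasoning

sumBelow-+ : ∀ m (f g : ℕ → ℕ) → (∑[ r < m ] (f r + g r)) ≡ sumBelow m f + sumBelow m g
sumBelow-+ zero    f g = refl
sumBelow-+ (suc m) f g = begin
  (∑[ r < m ] (f r + g r)) + (f m + g m)          ≡⟨ cong (_+ (f m + g m)) (sumBelow-+ m f g) ⟩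
  (sumBelow m f + sumBelow m g) + (f m + g m)     ≡⟨ +-exchange (sumBelow m f) (sumBelow m g) (f m) (g m) ⟩
  (sumBelow m f + f m) + (sumBelow m g + g m)     ∎
  where
  open ≡-Reasoning
  +-exchange : ∀ a b c d → (a + b) + (c + d) ≡ (a + c) + (b + d)
  +-exchange = solve-∀

sumBelow-*ˡ : ∀ m a (f : ℕ → ℕ) → (∑[ r < m ] (a * f r)) ≡ a * sumBelow m f
sumBelow-*ˡ zero    a f = sym (*-zeroʳ a)
sumBelow-*ˡ (suc m) a f =
  trans (cong (_+ a * f m) (sumBelow-*ˡ m a f)) (sym (*-distribˡ-+ a (sumBelow m f) (f m)))

sum-upTo : ∀ m (f : ℕ → ℕ) → sum (map f (upTo m)) ≡ sumBelow m f
sum-upTo m f = trans (cong sum (map-upTo f m)) (sum-applyUpTo m f)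
  where
  sum-applyUpTo : ∀ m (f : ℕ → ℕ) → sum (applyUpTo f m) ≡ sumBelow m f
  sum-applyUpTo zero    f = refl
  sum-applyUpTo (suc m) f =
    trans (cong (f 0 +_) (sum-applyUpTo m (f ∘ suc))) (sym (sumBelow-shift m f))

-- With b = k - 1, the number of triple-free words of length m ≥ 1 over k
-- letters is k · fullSum b m (r + 1 runs, C(r+1, m-r-1) run-length patterns),
-- and the number of those whose first letter avoids a fixed letter is
-- avoidSum b m (r runs, C(r, m-r) patterns, b choices for every run).

fullSum : ℕ → ℕ → ℕ
fullSum b m = ∑[ r < m ] ((suc r C (m ∸ suc r)) * b ^ r)

avoidSum : ℕ → ℕ → ℕ
avoidSum b m = ∑[ r < suc m ] ((r C (m ∸ r)) * b ^ r)

-- A word avoiding a letter has at least one run, each with b letter choices.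
avoidSum-suc : ∀ b m → avoidSum b (suc m) ≡ b * fullSum b (suc m)
avoidSum-suc b m = begin
  avoidSum b (suc m)
    ≡⟨ sumBelow-shift (suc m) _ ⟩
  (∑[ r < suc m ] ((suc r C (m ∸ r)) * (b * b ^ r)))
    ≡⟨ sumBelow-cong (suc m) (λ r _ → x∙yz≡y∙xz (suc r C (m ∸ r)) b (b ^ r)) ⟩
  (∑[ r < suc m ] (b * ((suc r C (m ∸ r)) * b ^ r)))
    ≡⟨ sumBelow-*ˡ (suc m) b _ ⟩
  b * fullSum b (suc m) ∎
  where
  open ≡-Reasoning
  x∙yz≡y∙xz : ∀ x y z → x * (y * z) ≡ y * (x * z)
  x∙yz≡y∙xz = solve-∀

pascal-gap : ∀ {r m} → r ≤ m → suc r C (suc m ∸ r) ≡ r C (suc m ∸ r) + r C (m ∸ r)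
pascal-gap {r} {m} r≤m rewrite +-∸-assoc 1 r≤m =
  trans (sym (nCk+nC[k+1]≡[n+1]C[k+1] r (m ∸ r))) (+-comm (r C (m ∸ r)) _)

-- Splitting by the length (1 or 2) of the first run.
fullSum-recurrence : ∀ b m → fullSum b (suc (suc m)) ≡ avoidSum b (suc m) + avoidSum b m
fullSum-recurrence b m = begin
  (∑[ r < suc m ] ((suc r C (suc m ∸ r)) * b ^ r)) + (suc (suc m) C (m ∸ m)) * b ^ suc m
    ≡⟨ cong₂ _+_ (sumBelow-cong (suc m) split) (cong (λ d → (suc (suc m) C d) * b ^ suc m) (n∸n≡0 m)) ⟩
  (∑[ r < suc m ] (g r + h r)) + 1 * b ^ suc m
    ≡⟨ cong (_+ 1 * b ^ suc m) (sumBelow-+ (suc m) g h) ⟩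
  (sumBelow (suc m) g + sumBelow (suc m) h) + 1 * b ^ suc m
    ≡⟨ +-rearrange (sumBelow (suc m) g) _ _ ⟩
  (sumBelow (suc m) g + 1 * b ^ suc m) + sumBelow (suc m) h
    ≡⟨ cong (λ d → sumBelow (suc m) g + (suc m C d) * b ^ suc m + sumBelow (suc m) h) (sym (n∸n≡0 m)) ⟩
  avoidSum b (suc m) + avoidSum b m ∎
  where
  open ≡-Reasoning
  g h : ℕ → ℕ
  g r = (r C (suc m ∸ r)) * b ^ r
  h r = (r C (m ∸ r)) * b ^ r
  split : ∀ r → r < suc m → (suc r C (suc m ∸ r)) * b ^ r ≡ g r + h r
  split r r<1+m = trans (cong (_* b ^ r) (pascal-gap (≤-pred r<1+m)))
                        (*-distribʳ-+ (b ^ r) (r C (suc m ∸ r)) (r C (m ∸ r)))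
  +-rearrange : ∀ x y z → (x + y) + z ≡ (x + z) + y
  +-rearrange = solve-∀

rhs-fullSum : ∀ n b → rhs n (suc b) ≡ suc b * fullSum b n
rhs-fullSum n b = begin
  rhs n (suc b)
    ≡⟨ sum-upTo n _ ⟩
  (∑[ r < n ] ((suc r C (n ∸ suc r)) * suc b * b ^ r))
    ≡⟨ sumBelow-cong n (λ r _ → xy∙z≡y∙xz (suc r C (n ∸ suc r)) (suc b) (b ^ r)) ⟩
  (∑[ r < n ] (suc b * ((suc r C (n ∸ suc r)) * b ^ r)))
    ≡⟨ sumBelow-*ˡ n (suc b) _ ⟩
  suc b * fullSum b n ∎
  where
  open ≡-Reasoning
  xy∙z≡y∙xz : ∀ x y z → x * y * z ≡ y * (x * z)
  xy∙z≡y∙xz = solve-∀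

Consecutive : ∀ {n} → Fin n → Fin n → Fin n → Set
Consecutive i j l = toℕ j ≡ suc (toℕ i) × toℕ l ≡ suc (toℕ j)

ConsecutiveTripleIn : ∀ {n} → (Fin n → Set) → Set
ConsecutiveTripleIn {n} X =
  Σ[ i ∈ Fin n ] Σ[ j ∈ Fin n ] Σ[ l ∈ Fin n ] Consecutive i j l × X i × X j × X l

S-short-edge : ∀ {n} {a b : Fin n} → S n a b → toℕ a ≤ suc (toℕ b) → toℕ b ≡ suc (toℕ a)
S-short-edge (inj₁ (b<a , a≢1+b)) a≤1+b = ⊥-elim (a≢1+b (≤-antisym a≤1+b b<a))
S-short-edge (inj₂ path)          _     = path

triple⇒cycle : ∀ {n} {X : Fin n → Set} → ConsecutiveTripleIn X → HasDirectedCycleIn (S n) X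
triple⇒cycle {n} {X} (i , j , l , (ij , jl) , Xi , Xj , Xl) =
  2 , f , injective , inX , (λ { fzero → inj₂ ij ; (fsuc fzero) → inj₂ jl }) , closing
  where
  f : Fin 3 → Fin n
  f fzero               = i
  f (fsuc fzero)        = j
  f (fsuc (fsuc fzero)) = l
  toℕ-l : toℕ l ≡ suc (suc (toℕ i))
  toℕ-l = trans jl (cong suc ij)
  toℕ-f : ∀ a → toℕ (f a) ≡ toℕ a + toℕ i
  toℕ-f fzero               = refl
  toℕ-f (fsuc fzero)        = ij
  toℕ-f (fsuc (fsuc fzero)) = toℕ-l
  injective : ∀ {a b} → f a ≡ f b → a ≡ b
  injective {a} {b} fa≡fb = toℕ-injective
    (+-cancelʳ-≡ (toℕ i) _ _ (trans (sym (toℕ-f a)) (trans (cong toℕ fa≡fb) (toℕ-f b))))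
  inX : ∀ a → X (f a)
  inX fzero               = Xi
  inX (fsuc fzero)        = Xj
  inX (fsuc (fsuc fzero)) = Xl
  closing : S n l i
  closing = inj₁ ( subst (toℕ i <_) (sym toℕ-l) (m<n⇒m<1+n (n<1+n (toℕ i)))
                 , λ l≡1+i → 1+n≢n (trans (sym toℕ-l) l≡1+i) )

-- In a directed cycle, the vertex of largest index and its two predecessors
-- on the cycle are consecutive vertices of S_n.
cycle⇒triple : ∀ {n} {X : Fin n → Set} → HasDirectedCycleIn (S n) X → ConsecutiveTripleIn X
cycle⇒triple {n} (m , f , _ , inX , edge , closing) =
  f (pred (pred top)) , f (pred top) , f top , (entry₂ , entry₁) , inX _ , inX _ , inX _
  where
  pred : Fin (suc m) → Fin (suc m)
  pred fzero    = fromℕ m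
  pred (fsuc t) = inject₁ t
  enters : ∀ t → S n (f (pred t)) (f t)
  enters fzero    = closing
  enters (fsuc t) = edge t
  top : Fin (suc m)
  top = argmax (toℕ ∘ f) fzero (allFin (suc m))
  maximal : ∀ t → toℕ (f t) ≤ toℕ (f top)
  maximal t = All.lookup (f[xs]≤f[argmax] {f = toℕ ∘ f} fzero (allFin (suc m))) (∈-allFin t)
  entry₁ : toℕ (f top) ≡ suc (toℕ (f (pred top)))
  entry₁ = S-short-edge (enters top) (m≤n⇒m≤1+n (maximal (pred top)))
  entry₂ : toℕ (f (pred top)) ≡ suc (toℕ (f (pred (pred top))))
  entry₂ = S-short-edge (enters (pred top))
                        (subst (toℕ (f (pred (pred top))) ≤_) entry₁ (maximal (pred (pred top))))

data HasTriple {A : Set} : ∀ {n} → Vec A n → Set where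
  here  : ∀ {n x} {w : Vec A n} → HasTriple (x ∷ x ∷ x ∷ w)
  there : ∀ {n x} {w : Vec A n} → HasTriple w → HasTriple (x ∷ w)

ColourClass : ∀ {n k} → Vec (Fin k) n → Fin k → Fin n → Set
ColourClass c col v = lookup c v ≡ col

triple⇒monochromatic : ∀ {n k} {c : Vec (Fin k) n} → HasTriple c →
                       Σ[ col ∈ Fin k ] ConsecutiveTripleIn (ColourClass c col)
triple⇒monochromatic {c = x ∷ _} here =
  x , fzero , fsuc fzero , fsuc (fsuc fzero) , (refl , refl) , refl , refl , refl
triple⇒monochromatic (there t) with triple⇒monochromatic t
... | col , i , j , l , (ij , jl) , ci , cj , cl =
  col , fsuc i , fsuc j , fsuc l , (cong suc ij , cong suc jl) , ci , cj , cl

monochromatic⇒triple : ∀ {n k} {col : Fin k} (c : Vec (Fin k) n) →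
                       ConsecutiveTripleIn (ColourClass c col) → HasTriple c
monochromatic⇒triple (_ ∷ _ ∷ _ ∷ _) (fzero , fsuc fzero , fsuc (fsuc fzero) , _ , refl , refl , refl) = here
monochromatic⇒triple (_ ∷ c) (fsuc i , fsuc j , fsuc l , (ij , jl) , ci , cj , cl) =
  there (monochromatic⇒triple c (i , j , l , (suc-injective ij , suc-injective jl) , ci , cj , cl))
monochromatic⇒triple _ (fzero , fzero , _ , (() , _) , _)
monochromatic⇒triple _ (fzero , fsuc (fsuc _) , _ , (() , _) , _)
monochromatic⇒triple _ (fzero , fsuc fzero , fzero , (_ , ()) , _)
monochromatic⇒triple _ (fzero , fsuc fzero , fsuc fzero , (_ , ()) , _)
monochromatic⇒triple _ (fzero , fsuc fzero , fsuc (fsuc (fsuc _)) , (_ , ()) , _)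
monochromatic⇒triple _ (fsuc _ , fzero , _ , (() , _) , _)
monochromatic⇒triple _ (fsuc _ , fsuc _ , fzero , (_ , ()) , _)

proper⇔triple-free : ∀ {n k} (c : Vec (Fin k) n) → Proper (S n) c ⇔ (¬ HasTriple c)
proper⇔triple-free c = mk⇔
  (λ proper t → let col , triple = triple⇒monochromatic t in proper col (triple⇒cycle triple))
  (λ free col cycle → free (monochromatic⇒triple c (cycle⇒triple cycle)))

module _ {A B : Set} (f : A → List B) where

  -- If every entry of f x carries the tag x, distinct blocks are disjoint, so
  -- duplicate-free blocks over duplicate-free labels concatenate duplicate-free.
  concatMap-unique : (tag : B → A) → (∀ x {y} → y ∈ f x → tag y ≡ x) →
                     (∀ x → Unique (f x)) → ∀ {xs} → Unique xs → Unique (concatMap f xs)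
  concatMap-unique tag tagged unique {xs} xs-unique =
    concat⁺ (All.map⁺ (All.universal unique xs)) (AllPairs.map⁺ (AllPairs.map disjoint xs-unique))
    where
    disjoint : ∀ {x x′} → x ≢ x′ → Disjoint (f x) (f x′)
    disjoint x≢x′ (y∈fx , y∈fx′) = x≢x′ (trans (sym (tagged _ y∈fx)) (tagged _ y∈fx′))

  concatMap-length : ∀ {c} → (∀ x → length (f x) ≡ c) → ∀ xs → length (concatMap f xs) ≡ length xs * c
  concatMap-length eq []       = refl
  concatMap-length eq (x ∷ xs) = trans (length-++ (f x)) (cong₂ _+_ (eq x) (concatMap-length eq xs))

module TripleFreeWords (k′ : ℕ) where

  Letter : Set
  Letter = Fin (suc k′)

  Word : ℕ → Set
  Word = Vec Letter

  Avoids : Maybe Letter → Letter → Set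
  Avoids nothing  x = ⊤
  Avoids (just p) x = x ≢ p

  HeadAvoids : ∀ {n} → Maybe Letter → Word n → Set
  HeadAvoids p []      = ⊤
  HeadAvoids p (x ∷ _) = Avoids p x

  firsts : Maybe Letter → List Letter
  firsts nothing  = allFin (suc k′)
  firsts (just p) = map (punchIn p) (allFin k′)

  firsts-complete : ∀ p {x} → Avoids p x → x ∈ firsts p
  firsts-complete nothing  _   = ∈-allFin _
  firsts-complete (just p) x≢p =
    subst (_∈ firsts (just p)) (punchIn-punchOut p≢x) (∈-map⁺ (punchIn p) (∈-allFin (punchOut p≢x)))
    where p≢x = x≢p ∘ sym

  firsts-sound : ∀ p {x} → x ∈ firsts p → Avoids p x
  firsts-sound nothing  _   = tt
  firsts-sound (just p) x∈ with ∈-map⁻ (punchIn p) x∈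
  ... | y , _ , refl = punchInᵢ≢i p y

  firsts-unique : ∀ p → Unique (firsts p)
  firsts-unique nothing  = allFin⁺ (suc k′)
  firsts-unique (just p) = map⁺ (punchIn-injective p _ _) (allFin⁺ k′)

  firsts-length : ∀ p → length (firsts (just p)) ≡ k′
  firsts-length p = trans (length-map (punchIn p) (allFin k′)) (length-tabulate {n = k′} id)

  ∷-∈-map⁻ : ∀ {n x y} {u : Word n} {us} → y ∷ u ∈ map (x ∷_) us → y ≡ x × u ∈ us
  ∷-∈-map⁻ y∷u∈ with ∈-map⁻ (_ ∷_) y∷u∈
  ... | _ , u∈ , refl = refl , u∈

  Admissible : ∀ {n} → Maybe Letter → Word n → Set
  Admissible p w = ¬ HasTriple w × HeadAvoids p w

  ∷-triple-free : ∀ {n x} {w : Word n} → Admissible (just x) w → ¬ HasTriple (x ∷ w)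
  ∷-triple-free (free , x∉) here      = x∉ refl
  ∷-triple-free (free , x∉) (there t) = free t

  ∷∷-triple-free : ∀ {n x} {w : Word n} → Admissible (just x) w → ¬ HasTriple (x ∷ x ∷ w)
  ∷∷-triple-free {w = _ ∷ _} (free , x∉) here      = x∉ refl
  ∷∷-triple-free             admissible  (there t) = ∷-triple-free admissible t

  run-ends : ∀ {n x} (w : Word n) → ¬ HasTriple (x ∷ x ∷ w) → HeadAvoids (just x) w
  run-ends []      _    = tt
  run-ends (y ∷ _) free = λ { refl → free here }

  -- The words with a first run of letter x, of length 1 (followed by a word of
  -- `singles`) or of length 2 (followed by a word of `doubles`).
  firstRun : ∀ {n} → Letter → List (Word (suc n)) → List (Word n) → List (Word (suc (suc n)))
  firstRun x singles doubles = map (x ∷_) singles ++ map (x ∷_) (map (x ∷_) doubles)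

  firstRun-sound : ∀ {n x} {singles : List (Word (suc n))} {doubles : List (Word n)} →
    (∀ {u} → u ∈ singles → Admissible (just x) u) → (∀ {u} → u ∈ doubles → Admissible (just x) u) →
    ∀ {w} → w ∈ firstRun x singles doubles → ¬ HasTriple w × head w ≡ x
  firstRun-sound {singles = singles} sound₁ sound₂ {_ ∷ _ ∷ _} w∈ with ∈-++⁻ (map _ singles) w∈
  ... | inj₁ w∈₁ with ∷-∈-map⁻ w∈₁
  ...   | refl , u∈ = ∷-triple-free (sound₁ u∈) , refl
  firstRun-sound sound₁ sound₂ {_ ∷ _ ∷ _} w∈ | inj₂ w∈₂ with ∷-∈-map⁻ w∈₂
  ...   | refl , u∈ with ∷-∈-map⁻ u∈
  ...     | refl , v∈ = ∷∷-triple-free (sound₂ v∈) , refl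

  firstRun-complete : ∀ {n} x y (w : Word n) {singles doubles} →
    (y ≢ x → y ∷ w ∈ singles) → (y ≡ x → w ∈ doubles) → x ∷ y ∷ w ∈ firstRun x singles doubles
  firstRun-complete x y w {singles} complete₁ complete₂ with y ≟ x
  ... | no y≢x   = ∈-++⁺ˡ (∈-map⁺ (x ∷_) (complete₁ y≢x))
  ... | yes refl = ∈-++⁺ʳ (map (x ∷_) singles) (∈-map⁺ (x ∷_) (∈-map⁺ (x ∷_) (complete₂ refl)))

  -- The two parts are disjoint because the words of `singles` do not start with x.
  firstRun-unique : ∀ {n x} {singles : List (Word (suc n))} {doubles : List (Word n)} →
    (∀ {u} → u ∈ singles → HeadAvoids (just x) u) → Unique singles → Unique doubles →
    Unique (firstRun x singles doubles)
  firstRun-unique avoids unique₁ unique₂ =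
    ++⁺ (map⁺ ∷-injectiveʳ unique₁) (map⁺ ∷-injectiveʳ (map⁺ ∷-injectiveʳ unique₂)) single≢double
    where
    single≢double : Disjoint _ _
    single≢double {_ ∷ _ ∷ _} (w∈₁ , w∈₂) with ∷-∈-map⁻ w∈₁ | ∷-∈-map⁻ w∈₂
    ... | _ , u∈ | _ , u∈′ with ∷-∈-map⁻ u∈′
    ...   | refl , _ = avoids u∈ refl

  firstRun-length : ∀ {n x} (singles : List (Word (suc n))) (doubles : List (Word n)) →
    length (firstRun x singles doubles) ≡ length singles + length doubles
  firstRun-length {x = x} singles doubles = begin
    length (map (x ∷_) singles ++ map (x ∷_) (map (x ∷_) doubles))
      ≡⟨ length-++ (map (x ∷_) singles) ⟩
    length (map (x ∷_) singles) + length (map (x ∷_) (map (x ∷_) doubles))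
      ≡⟨ cong₂ _+_ (length-map _ singles) (trans (length-map _ (map (x ∷_) doubles)) (length-map _ doubles)) ⟩
    length singles + length doubles ∎
    where open ≡-Reasoning

  -- words p n lists the triple-free words of length n whose first letter avoids p,
  -- grouped by their first letter x and by the length (1 or 2) of the first run.
  words : Maybe Letter → (n : ℕ) → List (Word n)
  words p zero          = [] ∷ []
  words p (suc zero)    = map (_∷ []) (firsts p)
  words p (suc (suc n)) = concatMap (λ x → firstRun x (words (just x) (suc n)) (words (just x) n)) (firsts p)

  startingWith : Letter → (n : ℕ) → List (Word (suc (suc n)))
  startingWith x n = firstRun x (words (just x) (suc n)) (words (just x) n)

  words-sound : ∀ p n {w : Word n} → w ∈ words p n → Admissible p w
  words-sound p zero          {[]}     _  = (λ ()) , tt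
  words-sound p (suc zero)    {_ ∷ []} w∈ with ∈-map⁻ (_∷ []) w∈
  ... | y , y∈ , refl = (λ { (there ()) }) , firsts-sound p y∈
  words-sound p (suc (suc n)) {x ∷ _}  w∈ =
    let y , y∈ , w∈y = find (∈-concatMap⁻ (λ y → startingWith y n) w∈)
        free , x≡y   = firstRun-sound (words-sound (just y) (suc n)) (words-sound (just y) n) w∈y
    in free , subst (Avoids p) (sym x≡y) (firsts-sound p y∈)

  words-complete : ∀ p {n} (w : Word n) → Admissible p w → w ∈ words p n
  words-complete p []          _           = here refl
  words-complete p (x ∷ [])    (_ , x∉)    = ∈-map⁺ (_∷ []) (firsts-complete p x∉)
  words-complete p (x ∷ y ∷ w) (free , x∉) =
    ∈-concatMap⁺ (λ x → startingWith x _) (lose (firsts-complete p x∉) (firstRun-complete x y w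
      (λ y≢x → words-complete (just x) (y ∷ w) (free ∘ there , y≢x))
      (λ { refl → words-complete (just x) w (free ∘ there ∘ there , run-ends w free) })))

  words-unique : ∀ p n → Unique (words p n)
  words-unique p zero          = All.[] AllPairs.∷ AllPairs.[]
  words-unique p (suc zero)    = map⁺ ∷-injectiveˡ (firsts-unique p)
  words-unique p (suc (suc n)) =
    concatMap-unique (λ x → startingWith x n) head
      (λ x w∈ → proj₂ (firstRun-sound (words-sound (just x) (suc n)) (words-sound (just x) n) w∈))
      (λ x → firstRun-unique (proj₂ ∘ words-sound (just x) (suc n))
                             (words-unique (just x) (suc n)) (words-unique (just x) n))
      (firsts-unique p)

  avoiding-count : ∀ x n → length (firsts (just x)) * fullSum k′ (suc n) ≡ avoidSum k′ (suc n)
  avoiding-count x n = trans (cong (_* fullSum k′ (suc n)) (firsts-length x)) (sym (avoidSum-suc k′ n))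

  length-words : ∀ p n → length (words p (suc n)) ≡ length (firsts p) * fullSum k′ (suc n)
  length-words-avoiding : ∀ x n → length (words (just x) n) ≡ avoidSum k′ n
  length-startingWith : ∀ x n → length (startingWith x n) ≡ fullSum k′ (suc (suc n))

  length-words p zero    = trans (length-map (_∷ []) (firsts p)) (sym (*-identityʳ _))
  length-words p (suc n) = concatMap-length (λ x → startingWith x n) (λ x → length-startingWith x n) (firsts p)

  length-words-avoiding x zero    = refl
  length-words-avoiding x (suc n) = trans (length-words (just x) n) (avoiding-count x n)

  length-startingWith x n = begin
    length (startingWith x n)
      ≡⟨ firstRun-length (words (just x) (suc n)) (words (just x) n) ⟩
    length (words (just x) (suc n)) + length (words (just x) n)
      ≡⟨ cong₂ _+_ (trans (length-words (just x) n) (avoiding-count x n)) (length-words-avoiding x n) ⟩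
    avoidSum k′ (suc n) + avoidSum k′ n
      ≡⟨ fullSum-recurrence k′ n ⟨
    fullSum k′ (suc (suc n)) ∎
    where open ≡-Reasoning

  triple-free-words : ∀ n → Σ[ L ∈ List (Word (suc n)) ]
    Unique L × (∀ w → (¬ HasTriple w) ⇔ (w ∈ L)) × length L ≡ suc k′ * fullSum k′ (suc n)
  triple-free-words n =
    words nothing (suc n) , words-unique nothing (suc n) ,
    (λ { w@(_ ∷ _) → mk⇔ (λ free → words-complete nothing w (free , tt))
                         (λ w∈ → proj₁ (words-sound nothing (suc n) w∈)) }) ,
    trans (length-words nothing n) (cong (_* fullSum k′ (suc n)) (length-tabulate {n = suc k′} id))

mainTheorem10 : ∀ (n : ℕ) → n ≥ 1 → ∀ (k : ℕ) → k ≥ 1 →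
    NumProperColorings (S n) k (rhs n k)
mainTheorem10 (suc n) _ (suc b) _ =
  let L , unique , triple-free⇔∈ , length≡ = TripleFreeWords.triple-free-words b n
  in L , unique , (λ c → triple-free⇔∈ c ⇔-∘ proper⇔triple-free c) ,
     trans length≡ (sym (rhs-fullSum (suc n) b))
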